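{- Let ${\sf TQ}$ be the theory in the language $\{<,\cdot,{}^{ -1},\mathbf{1}\}$ axiomatized by: ($\texttt{O}_1$) $\forall x,y\,(x<y\rightarrow y\not<x)$; ($\texttt{O}_2$) $\forall x,y,z\,(x<y<z\rightarrow x<z)$; ($\texttt{O}_3$) $\forall x,y\,(x<y\vee x=y\vee y<x)$; ($\texttt{M}_1$) $\forall x,y,z\,(x\cdot(y\cdot z)=(x\cdot y)\cdot z)$; ($\texttt{M}_2$) $\forall x\,(x\cdot\mathbf{1}=x)$; ($\texttt{M}_3$) $\forall x\,(x\cdot x^{ -1}=\mathbf{1})$; ($\texttt{M}_4$) $\forall x,y\,(x\cdot y=y\cdot x)$; ($\texttt{M}_5$) $\forall x,y,z\,(x<y\rightarrow x\cdot z<y\cdot z)$; ($\texttt{M}_6$) $\exists y\,(y\neq\mathbf{1})$; ($\texttt{M}_{10}$) for each $n\geqslant 1$: $\forall x,z\,\exists y\,(x<z\rightarrow x<y^n<z)$; ($\texttt{M}_{11}$) for each $n\geqslant 1$, $q\geqslant 1$ and natural numbers $m_0,\dots,m_{q-1}>1$: $\forall x_0,\dots,x_{q-1}\,\exists y\,\forall z\,\bigwedge_{j<q,\ m_j\nmid n}(y^n\cdot x_j\neq z^{m_j})$. Let $n>1$, $q\geqslant 1$ and $m_0,\dots,m_{q-1}>1$ be natural numbers, and let $t,s_0,\dots,s_{q-1},u,v$ be variables distinct from $x$. Then ${\sf TQ}$ proves that each of the formulas $\exists x\,[\Re_n(x\cdot t)\wedge\bigwedge_{j<q}\neg\Re_{m_j}(x\cdot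 s_j)]$, $\exists x\,[u<x\wedge\Re_n(x\cdot t)\wedge\bigwedge_{j<q}\neg\Re_{m_j}(x\cdot s_j)]$ and $\exists x\,[x<v\wedge\Re_n(x\cdot t)\wedge\bigwedge_{j<q}\neg\Re_{m_j}(x\cdot s_j)]$ is equivalent to $\bigwedge_{j<q,\ m_j\mid n}\neg\Re_{m_j}(t^{ -1}\cdot s_j)$, and that the formula $\exists x\,[u<x<v\wedge\Re_n(x\cdot t)\wedge\bigwedge_{j<q}\neg\Re_{m_j}(x\cdot s_j)]$ is equivalent to $\bigwedge_{j<q,\ m_j\mid n}\neg\Re_{m_j}(t^{ -1}\cdot s_j)\wedge u<v$.
   Context: $y^n$ abbreviates the $n$-fold product $y\cdot\ldots\cdot y$; an empty conjunction is true. For $m>1$, $\Re_m(y)$ abbreviates the formula $\exists w\,(y=w^m)$. -}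

module Defs where

open import Level using (Level; _⊔_; suc)
open import Data.Nat using (ℕ; zero; suc; _>_; _≥_)
open import Data.Nat.Divisibility using (_∣_)
open import Data.Fin using (Fin)
open import Data.Product using (Σ; ∃; _×_)
open import Data.Sum using (_⊎_)
open import Relation.Nullary using (¬_)
open import Relation.Binary.PropositionalEquality using (_≡_)

record Structure (a ℓ : Level) : Set (Level.suc (a ⊔ ℓ)) where
  infixl 7 _·_
  infix 4 _<_
  field
    Carrier : Set a
    _<_     : Carrier → Carrier → Set ℓ
    _·_     : Carrier → Carrier → Carrier
    _⁻¹     : Carrier → Carrier
    𝟏       : Carrier

  _^_ : Carrier → ℕ → Carrier
  y ^ zero  = 𝟏
  y ^ suc n = y · (y ^ n)

  ℜ : ℕ → Carrier → Set a
  ℜ m y = ∃ λ w → y ≡ w ^ m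

record IsTQ {a ℓ : Level} (S : Structure a ℓ) : Set (a ⊔ ℓ) where
  open Structure S
  field
    O₁ : ∀ x y → x < y → ¬ (y < x)
    O₂ : ∀ x y z → x < y → y < z → x < z
    O₃ : ∀ x y → x < y ⊎ x ≡ y ⊎ y < x
    M₁ : ∀ x y z → x · (y · z) ≡ (x · y) · z
    M₂ : ∀ x → x · 𝟏 ≡ x
    M₃ : ∀ x → x · (x ⁻¹) ≡ 𝟏
    M₄ : ∀ x y → x · y ≡ y · x
    M₅ : ∀ x y z → x < y → x · z < y · z
    M₆ : ∃ λ y → ¬ (y ≡ 𝟏)
    M₁₀ : ∀ (n : ℕ) → n ≥ 1 → ∀ x z → ∃ λ y → (x < z → (x < y ^ n) × (y ^ n < z))
    M₁₁ : ∀ (n : ℕ) → n ≥ 1 → ∀ (q : ℕ) → q ≥ 1 → (m : Fin q → ℕ) → (∀ j → m j > 1) →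
          ∀ (x : Fin q → Carrier) → ∃ λ y → ∀ z → ∀ j → ¬ (m j ∣ n) →
          ¬ ((y ^ n) · x j ≡ z ^ m j)

record TQModel (a ℓ : Level) : Set (Level.suc (a ⊔ ℓ)) where
  field
    structure : Structure a ℓ
    isTQ      : IsTQ structure
  open Structure structure public
  open IsTQ isTQ public

{-# OPTIONS --safe #-}

-- If x·t is an n-th power and m ∣ n, then x·s = (x·t)·(t⁻¹·s) is an m-th power exactly
-- when t⁻¹·s is; this gives the necessity of the criterion.  Conversely, take y from M₁₁
-- for the elements t⁻¹·sⱼ and put x = d^(Mn)·yⁿ·t⁻¹ with M = ∏ mⱼ.  Then x·t = (d^M·y)ⁿ;
-- for mⱼ ∣ n the criterion applies as above, and for mⱼ ∤ n the element x·sⱼ differs from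
-- yⁿ·t⁻¹·sⱼ by the mⱼ-th power d^(Mn), so M₁₁ applies.  Finally M₁₀ for the exponent Mn
-- places such an x in any interval, and M₆ gives intervals above and below every point.
module Submission where

open import Defs
open import Level using (Level)
open import Data.Nat using (ℕ; _>_; _≥_)
open import Data.Nat.Divisibility using (_∣_)
open import Data.Fin using (Fin)
open import Data.Product using (∃; _×_)
open import Relation.Nullary using (¬_)
open import Function.Bundles using (_⇔_)

open import Algebra.Bundles using (AbelianGroup)
open import Algebra.Structures using (IsAbelianGroup)
open import Data.Nat using (zero; suc; _*_; >-nonZero; >-nonZero⁻¹)
open import Data.Nat.Properties using (*-comm; *-mono-≤; <⇒≤)
open import Data.Nat.Divisibility using (divides; _∣?_; ∣-trans; m∣m*n; n∣m*n)
open import Data.Nat.ListAction using (product)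
open import Data.Nat.ListAction.Properties using (∈⇒∣product; product≢0)
open import Data.List using (tabulate)
open import Data.List.Membership.Propositional.Properties using (∈-tabulate⁺)
import Data.List.Relation.Unary.All.Properties as All
open import Data.Product using (_,_; proj₂)
open import Data.Sum using (inj₁; inj₂)
open import Function using (_∘_)
open import Relation.Nullary using (yes; no; contradiction)
open import Relation.Binary.PropositionalEquality
open import Function.Bundles using (mk⇔; Equivalence)

module AbelianGroupPowers {a ℓ : Level} (S : Structure a ℓ)
  (isAbelianGroup : IsAbelianGroup _≡_ (Structure._·_ S) (Structure.𝟏 S) (Structure._⁻¹ S)) where

  open Structure S

  abelianGroup : AbelianGroup a a
  abelianGroup = record { isAbelianGroup = isAbelianGroup }

  open AbelianGroup abelianGroup public using (assoc; identityˡ)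
  open AbelianGroup abelianGroup using (inverseʳ; group; commutativeMonoid)
  open import Algebra.Properties.Group group public using (//-rightDividesˡ)
  open import Algebra.Properties.Group group using (inverseʳ-unique; \\-leftDividesˡ; \\-leftDividesʳ)
  open import Algebra.Properties.CommutativeMonoid.Mult commutativeMonoid
    using (×-distrib-+; ×-assocˡ) renaming (_×_ to _×ᴹ_)
  open ≡-Reasoning

  ^≗×ᴹ : ∀ x n → x ^ n ≡ n ×ᴹ x
  ^≗×ᴹ x zero    = refl
  ^≗×ᴹ x (suc n) = cong (x ·_) (^≗×ᴹ x n)

  ^-distrib-· : ∀ x y n → (x · y) ^ n ≡ x ^ n · y ^ n
  ^-distrib-· x y n = begin
    (x · y) ^ n        ≡⟨ ^≗×ᴹ (x · y) n ⟩
    n ×ᴹ (x · y)       ≡⟨ ×-distrib-+ x y n ⟩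
    n ×ᴹ x · n ×ᴹ y    ≡⟨ sym (cong₂ _·_ (^≗×ᴹ x n) (^≗×ᴹ y n)) ⟩
    x ^ n · y ^ n      ∎

  ^-* : ∀ x i j → x ^ (i * j) ≡ (x ^ i) ^ j
  ^-* x i j = begin
    x ^ (i * j)        ≡⟨ ^≗×ᴹ x (i * j) ⟩
    (i * j) ×ᴹ x       ≡⟨ cong (_×ᴹ x) (*-comm i j) ⟩
    (j * i) ×ᴹ x       ≡⟨ sym (×-assocˡ x j i) ⟩
    j ×ᴹ (i ×ᴹ x)      ≡⟨ sym (cong (j ×ᴹ_) (^≗×ᴹ x i)) ⟩
    j ×ᴹ (x ^ i)       ≡⟨ sym (^≗×ᴹ (x ^ i) j) ⟩
    (x ^ i) ^ j        ∎

  𝟏^ : ∀ n → 𝟏 ^ n ≡ 𝟏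
  𝟏^ zero    = refl
  𝟏^ (suc n) = trans (cong (𝟏 ·_) (𝟏^ n)) (identityˡ 𝟏)

  ⁻¹-^ : ∀ x n → (x ⁻¹) ^ n ≡ (x ^ n) ⁻¹
  ⁻¹-^ x n = inverseʳ-unique (x ^ n) ((x ⁻¹) ^ n) (begin
    x ^ n · (x ⁻¹) ^ n  ≡⟨ sym (^-distrib-· x (x ⁻¹) n) ⟩
    (x · x ⁻¹) ^ n      ≡⟨ cong (_^ n) (inverseʳ x) ⟩
    𝟏 ^ n               ≡⟨ 𝟏^ n ⟩
    𝟏                   ∎)

  ℜ-· : ∀ {k x y} → ℜ k x → ℜ k y → ℜ k (x · y)
  ℜ-· {k} (w , refl) (z , refl) = w · z , sym (^-distrib-· w z k)

  ℜ-⁻¹ : ∀ {k x} → ℜ k x → ℜ k (x ⁻¹)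
  ℜ-⁻¹ {k} (w , refl) = w ⁻¹ , sym (⁻¹-^ w k)

  ℜ-∣ : ∀ {k n x} → k ∣ n → ℜ n x → ℜ k x
  ℜ-∣ {k} (divides i refl) (w , refl) = w ^ i , ^-* w i k

  ℜ-cancelˡ : ∀ {k x y} → ℜ k x → ℜ k (x · y) → ℜ k y
  ℜ-cancelˡ {k} {x} {y} ℜx ℜxy = subst (ℜ k) (\\-leftDividesʳ x y) (ℜ-· {k} (ℜ-⁻¹ {k} ℜx) ℜxy)

  x·y≡[x·z]·[z⁻¹·y] : ∀ x y z → x · y ≡ (x · z) · (z ⁻¹ · y)
  x·y≡[x·z]·[z⁻¹·y] x y z = sym (begin
    (x · z) · (z ⁻¹ · y)  ≡⟨ assoc x z (z ⁻¹ · y) ⟩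
    x · (z · (z ⁻¹ · y))  ≡⟨ cong (x ·_) (\\-leftDividesˡ z y) ⟩
    x · y                 ∎)

  ℜ[x·y]⇔ℜ[z⁻¹·y] : ∀ k x y z → ℜ k (x · z) → ℜ k (x · y) ⇔ ℜ k (z ⁻¹ · y)
  ℜ[x·y]⇔ℜ[z⁻¹·y] k x y z ℜxz = mk⇔
    (ℜ-cancelˡ {k} ℜxz ∘ subst (ℜ k) (x·y≡[x·z]·[z⁻¹·y] x y z))
    (subst (ℜ k) (sym (x·y≡[x·z]·[z⁻¹·y] x y z)) ∘ ℜ-· {k} ℜxz)

∏ : ∀ {q} → (Fin q → ℕ) → ℕ
∏ m = product (tabulate m)

∣∏ : ∀ {q} (m : Fin q → ℕ) j → m j ∣ ∏ m
∣∏ m j = ∈⇒∣product (∈-tabulate⁺ j)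

∏-positive : ∀ {q} {m : Fin q → ℕ} → (∀ j → m j > 0) → ∏ m > 0
∏-positive {m = m} m>0 = >-nonZero⁻¹ (∏ m) {{product≢0 (All.tabulate⁺ (>-nonZero ∘ m>0))}}

module TQ {a ℓ : Level} (𝓜 : TQModel a ℓ) where
  open TQModel 𝓜

  isAbelianGroup : IsAbelianGroup _≡_ _·_ 𝟏 _⁻¹
  isAbelianGroup = record
    { isGroup = record
      { isMonoid = record
        { isSemigroup = record
          { isMagma = record { isEquivalence = isEquivalence ; ∙-cong = cong₂ _·_ }
          ; assoc = λ x y z → sym (M₁ x y z)
          }
        ; identity = (λ x → trans (M₄ 𝟏 x) (M₂ x)) , M₂
        }
      ; inverse = (λ x → trans (M₄ (x ⁻¹) x) (M₃ x)) , M₃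
      ; ⁻¹-cong = cong _⁻¹
      }
    ; comm = M₄
    }

  open AbelianGroupPowers structure isAbelianGroup public

  <𝟏⇒𝟏<⁻¹ : ∀ {x} → x < 𝟏 → 𝟏 < x ⁻¹
  <𝟏⇒𝟏<⁻¹ {x} x<𝟏 = subst₂ _<_ (M₃ x) (identityˡ (x ⁻¹)) (M₅ x 𝟏 (x ⁻¹) x<𝟏)

  𝟏<⇒⁻¹<𝟏 : ∀ {x} → 𝟏 < x → x ⁻¹ < 𝟏
  𝟏<⇒⁻¹<𝟏 {x} 𝟏<x = subst₂ _<_ (identityˡ (x ⁻¹)) (M₃ x) (M₅ 𝟏 x (x ⁻¹) 𝟏<x)

  ∃𝟏< : ∃ (𝟏 <_)
  ∃𝟏< with M₆
  ... | y , y≢𝟏 with O₃ y 𝟏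
  ...   | inj₁ y<𝟏        = y ⁻¹ , <𝟏⇒𝟏<⁻¹ y<𝟏
  ...   | inj₂ (inj₁ y≡𝟏) = contradiction y≡𝟏 y≢𝟏
  ...   | inj₂ (inj₂ 𝟏<y) = y , 𝟏<y

  ∃<𝟏 : ∃ (_< 𝟏)
  ∃<𝟏 = let w , 𝟏<w = ∃𝟏< in w ⁻¹ , 𝟏<⇒⁻¹<𝟏 𝟏<w

  noMaximum : ∀ u → ∃ (u <_)
  noMaximum u = let w , 𝟏<w = ∃𝟏< in w · u , subst (_< w · u) (identityˡ u) (M₅ 𝟏 w u 𝟏<w)

  noMinimum : ∀ v → ∃ (_< v)
  noMinimum v = let w , w<𝟏 = ∃<𝟏 in w · v , subst (w · v <_) (identityˡ v) (M₅ w 𝟏 v w<𝟏)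

  powers-dense-in-cosets : ∀ e → e ≥ 1 → ∀ c {u v} → u < v →
                           ∃ λ d → u < d ^ e · c × d ^ e · c < v
  powers-dense-in-cosets e e≥1 c {u} {v} u<v =
    let d , between = M₁₀ e e≥1 (u · c ⁻¹) (v · c ⁻¹)
        u<dᵉ , dᵉ<v = between (M₅ u v (c ⁻¹) u<v)
    in d , subst (_< d ^ e · c) (//-rightDividesˡ c u) (M₅ _ _ c u<dᵉ)
         , subst (d ^ e · c <_) (//-rightDividesˡ c v) (M₅ _ _ c dᵉ<v)

  module Elimination (n : ℕ) {q : ℕ} (m : Fin q → ℕ) (t : Carrier) (s : Fin q → Carrier) where
    open ≡-Reasoning

    Solution : Carrier → Set a
    Solution x = ℜ n (x · t) × (∀ j → ¬ ℜ (m j) (x · s j))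

    Criterion : Set a
    Criterion = ∀ j → m j ∣ n → ¬ ℜ (m j) (t ⁻¹ · s j)

    solution⇒criterion : ∀ {x} → Solution x → Criterion
    solution⇒criterion {x} (ℜxt , ¬ℜxs) j mⱼ∣n =
      ¬ℜxs j ∘ Equivalence.from (ℜ[x·y]⇔ℜ[z⁻¹·y] (m j) x (s j) t (ℜ-∣ mⱼ∣n ℜxt))

    solution-in-coset : Criterion → ∀ {y} → (∀ j → ¬ (m j ∣ n) → ¬ ℜ (m j) (y ^ n · (t ⁻¹ · s j))) →
                        ∀ d → Solution (d ^ (∏ m * n) · (y ^ n · t ⁻¹))
    solution-in-coset criterion {y} ¬ℜyⁿt⁻¹s d = ℜxt , ¬ℜxs
      where
      x E : Carrier
      E = d ^ (∏ m * n)
      x = E · (y ^ n · t ⁻¹)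

      x·t≡E·yⁿ : x · t ≡ E · y ^ n
      x·t≡E·yⁿ = trans (assoc E (y ^ n · t ⁻¹) t) (cong (E ·_) (//-rightDividesˡ t (y ^ n)))

      ℜxt : ℜ n (x · t)
      ℜxt = subst (ℜ n) (sym x·t≡E·yⁿ) (ℜ-· {n} (ℜ-∣ (n∣m*n (∏ m)) (d , refl)) (y , refl))

      x·sⱼ≡E·[yⁿ·t⁻¹sⱼ] : ∀ j → x · s j ≡ E · (y ^ n · (t ⁻¹ · s j))
      x·sⱼ≡E·[yⁿ·t⁻¹sⱼ] j = begin
        x · s j                     ≡⟨ x·y≡[x·z]·[z⁻¹·y] x (s j) t ⟩
        (x · t) · (t ⁻¹ · s j)      ≡⟨ cong (_· (t ⁻¹ · s j)) x·t≡E·yⁿ ⟩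
        (E · y ^ n) · (t ⁻¹ · s j)  ≡⟨ assoc E (y ^ n) (t ⁻¹ · s j) ⟩
        E · (y ^ n · (t ⁻¹ · s j))  ∎

      ¬ℜxs : ∀ j → ¬ ℜ (m j) (x · s j)
      ¬ℜxs j with m j ∣? n
      ... | yes mⱼ∣n = criterion j mⱼ∣n ∘ Equivalence.to (ℜ[x·y]⇔ℜ[z⁻¹·y] (m j) x (s j) t (ℜ-∣ mⱼ∣n ℜxt))
      ... | no  mⱼ∤n = ¬ℜyⁿt⁻¹s j mⱼ∤n ∘ ℜ-cancelˡ {m j} ℜE ∘ subst (ℜ (m j)) (x·sⱼ≡E·[yⁿ·t⁻¹sⱼ] j)
        where
        ℜE : ℜ (m j) E
        ℜE = ℜ-∣ (∣-trans (∣∏ m j) (m∣m*n n)) (d , refl)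

    criterion⇒solution-between : n ≥ 1 → q ≥ 1 → (∀ j → m j > 1) → Criterion →
                                 ∀ {u v} → u < v → ∃ λ x → u < x × x < v × Solution x
    criterion⇒solution-between n≥1 q≥1 m>1 criterion u<v =
      let y , ¬yⁿt⁻¹s≡zᵐ = M₁₁ n n≥1 q q≥1 m m>1 (λ j → t ⁻¹ · s j)
          e≥1 = *-mono-≤ (∏-positive (<⇒≤ ∘ m>1)) n≥1
          d , u<x , x<v = powers-dense-in-cosets (∏ m * n) e≥1 (y ^ n · t ⁻¹) u<v
      in  d ^ (∏ m * n) · (y ^ n · t ⁻¹) , u<x , x<v
        , solution-in-coset criterion (λ j mⱼ∤n (z , eq) → ¬yⁿt⁻¹s≡zᵐ z j mⱼ∤n eq) d

mainTheorem20 : ∀ {a ℓ : Level} (𝓜 : TQModel a ℓ) → let open TQModel 𝓜 in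
    ∀ (n : ℕ) → n > 1 → ∀ (q : ℕ) → q ≥ 1 → (m : Fin q → ℕ) → (∀ j → m j > 1) →
    ∀ (t : Carrier) (s : Fin q → Carrier) (u v : Carrier) →
    ((∃ λ x → ℜ n (x · t) × (∀ j → ¬ ℜ (m j) (x · s j)))
       ⇔ (∀ j → m j ∣ n → ¬ ℜ (m j) ((t ⁻¹) · s j)))
    × ((∃ λ x → u < x × ℜ n (x · t) × (∀ j → ¬ ℜ (m j) (x · s j)))
       ⇔ (∀ j → m j ∣ n → ¬ ℜ (m j) ((t ⁻¹) · s j)))
    × ((∃ λ x → x < v × ℜ n (x · t) × (∀ j → ¬ ℜ (m j) (x · s j)))
       ⇔ (∀ j → m j ∣ n → ¬ ℜ (m j) ((t ⁻¹) · s j)))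
    × ((∃ λ x → u < x × x < v × ℜ n (x · t) × (∀ j → ¬ ℜ (m j) (x · s j)))
       ⇔ ((∀ j → m j ∣ n → ¬ ℜ (m j) ((t ⁻¹) · s j)) × u < v))
mainTheorem20 𝓜 n n>1 q q≥1 m m>1 t s u v =
    mk⇔ (λ (_ , sol) → solution⇒criterion sol)
        (λ crit → let x , _ , _ , sol = between crit (proj₂ (noMaximum 𝟏)) in x , sol)
  , mk⇔ (λ (_ , _ , sol) → solution⇒criterion sol)
        (λ crit → let x , u<x , _ , sol = between crit (proj₂ (noMaximum u)) in x , u<x , sol)
  , mk⇔ (λ (_ , _ , sol) → solution⇒criterion sol)
        (λ crit → let x , _ , x<v , sol = between crit (proj₂ (noMinimum v)) in x , x<v , sol)
  , mk⇔ (λ (x , u<x , x<v , sol) → solution⇒criterion sol , O₂ u x v u<x x<v)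
        (λ (crit , u<v) → between crit u<v)
  where
  open TQModel 𝓜
  open TQ 𝓜 using (noMaximum; noMinimum; module Elimination)
  open Elimination n m t s

  between : Criterion → ∀ {u v} → u < v → ∃ λ x → u < x × x < v × Solution x
  between = criterion⇒solution-between (<⇒≤ n>1) q≥1 m>1
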